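{- The categorical rewriting system for graphs based on single pushouts, $\mathcal{R}_{\mathrm{spo}}$, is functorial.
   Context: A categorical rewriting system consists of a span of categories $\mathcal{L}\xleftarrow{\mathbf{L}}\mathcal{P}\xrightarrow{\mathbf{R}}\mathcal{R}$ and, for each object $\rho$ of $\mathcal{P}$ (a rule), a partial function $S_\rho$ from morphisms of $\mathcal{L}$ with source $\mathbf{L}(\rho)$ to morphisms of $\mathcal{P}$ with source $\rho$, with $\mathbf{L}(S_\rho(f))=f$ for $f\in\mathrm{dom}(S_\rho)$. It is functorial if for every rule $\rho$ with $\mathbf{L}(\rho)=L$: (i) $\mathrm{id}_L\in\mathrm{dom}(S_\rho)$ and $S_\rho(\mathrm{id}_L)=\mathrm{id}_\rho$; (ii) for $f_1:L\to L_1$, $f_2:L_1\to L_2$ in $\mathcal{L}$, if $f_1\in\mathrm{dom}(S_\rho)$ and $f_2\in\mathrm{dom}(S_{\rho_1})$ with $\rho_1$ the target of $S_\rho(f_1)$, then $f_2\circ f_1\in\mathrm{dom}(S_\rho)$ and $S_{\rho_1}(f_2)\circ S_\rho(f_1)=S_\rho(f_2\circ f_1)$ (equalities up to isomorphism). Given a category $\mathcal{C}$ with wide subcategories $\mathcal{M}$ and $\mathcal{D}$, the generalized arrow category $\mathcal{D}^{\to\mathcal{M}}$ has as objects the morphisms of $\mathcal{D}$ and as morphisms from $\rho:L\to R$ to $\rho_1:L_1\to R_1$ the pairs $(f:L\to L_1,g:R\to R_1)$ of morphisms of $\mathcal{M}$ with $g\circ\rho=\rho_1\circ f$ in $\mathcal{C}$;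 the direct arrows-based span is $\mathcal{M}\xleftarrow{\mathrm{Src}}\mathcal{D}^{\to\mathcal{M}}\xrightarrow{\mathrm{Tgt}}\mathcal{M}$ (source and target functors). Graphs: a set of nodes, a set of edges, source and target functions; graph morphisms preserve sources and targets. A partial graph morphism $L\rightharpoonup R$ is a graph morphism from a subgraph $\mathrm{dom}$ of $L$ to $R$; $\mathbf{Graph}^p$ is the category of graphs with partial morphisms, containing the category $\mathbf{Graph}$ of graphs and total morphisms as a wide subcategory. Given $r:L\rightharpoonup R$, a total $f:L\to L_1$ is conflict-free w.r.t. $r$ if no item $x\in\mathrm{dom}(r)$ and item $y\notin\mathrm{dom}(r)$ of $L$ satisfy $f(x)=f(y)$. $\mathcal{R}_{\mathrm{spo}}$ is the direct arrows-based span on $\mathcal{C}=\mathbf{Graph}^p$ with rules in $\mathcal{D}$ = the wide subcategory of partial monomorphisms (injective partial morphisms) and matches in $\mathcal{M}=\mathbf{Graph}$, with, for each rule $r:L\rightharpoonup R$, $\mathrm{dom}(S_r)$ = the matches $f:L\to L_1$ conflict-free w.r.t. $r$, and $S_r(f)=(f,g):r\to r_1$ given by the pushout $(r_1:L_1\rightharpoonup R_1, g:R\to R_1)$ of $r$ and $f$ in $\mathbf{Graph}^p$ (it is known that this pushout exists, $r_1$ is a partial monomorphism and $g$ is total). -}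

module Defs where

open import Data.Maybe using (Maybe; just; nothing; _>>=_)
open import Data.Maybe.Properties using (just-injective)
open import Data.Product using (Σ; _×_; _,_)
open import Data.Empty using (⊥)
open import Relation.Binary.PropositionalEquality using (_≡_; refl; sym; trans; cong)

record Graph : Set₁ where
  field
    Node : Set
    Edge : Set
    src  : Edge → Node
    tgt  : Edge → Node
open Graph public

record Hom (G H : Graph) : Set where
  field
    fN   : Node G → Node H
    fE   : Edge G → Edge H
    fSrc : ∀ e → src H (fE e) ≡ fN (src G e)
    fTgt : ∀ e → tgt H (fE e) ≡ fN (tgt G e)
open Hom public

idₕ : ∀ {G} → Hom G G
idₕ = record { fN = λ x → x ; fE = λ e → e ; fSrc = λ _ → refl ; fTgt = λ _ → refl }

_∘ₕ_ : ∀ {G H K} → Hom H K → Hom G H → Hom G K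
g ∘ₕ f = record
  { fN = λ x → fN g (fN f x)
  ; fE = λ e → fE g (fE f e)
  ; fSrc = λ e → trans (fSrc g (fE f e)) (cong (fN g) (fSrc f e))
  ; fTgt = λ e → trans (fTgt g (fE f e)) (cong (fN g) (fTgt f e))
  }

_≈ₕ_ : ∀ {G H} → Hom G H → Hom G H → Set
f ≈ₕ g = (∀ x → fN f x ≡ fN g x) × (∀ e → fE f e ≡ fE g e)

IsIso : ∀ {G H} → Hom G H → Set
IsIso {G} {H} h = Σ (Hom H G) λ h' → ((h' ∘ₕ h) ≈ₕ idₕ) × ((h ∘ₕ h') ≈ₕ idₕ)

-- A partial morphism L ⇀ R is given by partial maps on nodes and edges
-- (nothing = undefined) such that the domain is a subgraph (the source
-- and target of a defined edge are defined) and sources/targets are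
-- preserved on the domain.

record PHom (G H : Graph) : Set where
  field
    pN   : Node G → Maybe (Node H)
    pE   : Edge G → Maybe (Edge H)
    pSrc : ∀ e e' → pE e ≡ just e' → pN (src G e) ≡ just (src H e')
    pTgt : ∀ e e' → pE e ≡ just e' → pN (tgt G e) ≡ just (tgt H e')
open PHom public

compSrc : ∀ {G H K} (q : PHom H K) (p : PHom G H) e e'' →
          (pE p e >>= pE q) ≡ just e'' →
          (pN p (src G e) >>= pN q) ≡ just (src K e'')
compSrc q p e e'' eq with pE p e in eq1
compSrc q p e e'' eq | just e' rewrite pSrc p e e' eq1 = pSrc q e' e'' eq

compTgt : ∀ {G H K} (q : PHom H K) (p : PHom G H) e e'' →
          (pE p e >>= pE q) ≡ just e'' →
          (pN p (tgt G e) >>= pN q) ≡ just (tgt K e'')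
compTgt q p e e'' eq with pE p e in eq1
compTgt q p e e'' eq | just e' rewrite pTgt p e e' eq1 = pTgt q e' e'' eq

_∘ₚ_ : ∀ {G H K} → PHom H K → PHom G H → PHom G K
q ∘ₚ p = record
  { pN = λ x → pN p x >>= pN q
  ; pE = λ e → pE p e >>= pE q
  ; pSrc = compSrc q p
  ; pTgt = compTgt q p
  }

_≈ₚ_ : ∀ {G H} → PHom G H → PHom G H → Set
p ≈ₚ q = (∀ x → pN p x ≡ pN q x) × (∀ e → pE p e ≡ pE q e)

toP : ∀ {G H} → Hom G H → PHom G H
toP {G} {H} f = record
  { pN = λ x → just (fN f x)
  ; pE = λ e → just (fE f e)
  ; pSrc = λ e e' eq → cong just (trans (sym (fSrc f e)) (cong (src H) (just-injective eq)))
  ; pTgt = λ e e' eq → cong just (trans (sym (fTgt f e)) (cong (tgt H) (just-injective eq)))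
  }

IsPartialMono : ∀ {L R} → PHom L R → Set
IsPartialMono {L} {R} r =
  (∀ (x y : Node L) (z : Node R) → pN r x ≡ just z → pN r y ≡ just z → x ≡ y) ×
  (∀ (e d : Edge L) (c : Edge R) → pE r e ≡ just c → pE r d ≡ just c → e ≡ d)

ConflictFree : ∀ {L R L₁} → PHom L R → Hom L L₁ → Set
ConflictFree {L} {R} r f =
  (∀ (x y : Node L) (z : Node R) → pN r x ≡ just z → pN r y ≡ nothing →
     fN f x ≡ fN f y → ⊥) ×
  (∀ (e d : Edge L) (c : Edge R) → pE r e ≡ just c → pE r d ≡ nothing →
     fE f e ≡ fE f d → ⊥)

IsPushout : ∀ {L R L₁ R₁} → PHom L R → Hom L L₁ → PHom L₁ R₁ → PHom R R₁ → Set₁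
IsPushout {L} {R} {L₁} {R₁} r f r₁ g =
  ((g ∘ₚ r) ≈ₚ (r₁ ∘ₚ toP f)) ×
  (∀ (X : Graph) (a : PHom R X) (b : PHom L₁ X) →
     (a ∘ₚ r) ≈ₚ (b ∘ₚ toP f) →
     Σ (PHom R₁ X) λ u →
       ((u ∘ₚ g) ≈ₚ a) × ((u ∘ₚ r₁) ≈ₚ b) ×
       (∀ (v : PHom R₁ X) → (v ∘ₚ g) ≈ₚ a → (v ∘ₚ r₁) ≈ₚ b → v ≈ₚ u))

-- Morphisms of the generalized arrow category D^{→M} are pairs (f , g)
-- of total morphisms.

EqUpToIso : ∀ {L R La Ra Lb Rb} →
            (ra : PHom La Ra) → Hom L La → Hom R Ra →
            (rb : PHom Lb Rb) → Hom L Lb → Hom R Rb → Set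
EqUpToIso {La = La} {Ra} {Lb} {Rb} ra fa ga rb fb gb =
  Σ (Hom La Lb) λ k → Σ (Hom Ra Rb) λ h →
    IsIso k × IsIso h ×
    ((toP h ∘ₚ ra) ≈ₚ (rb ∘ₚ toP k)) ×
    ((k ∘ₕ fa) ≈ₕ fb) × ((h ∘ₕ ga) ≈ₕ gb)

-- S_r(f) = (f , g) : r → r₁ where (r₁ , g)
-- is the pushout of r and f (g total), defined for conflict-free f.
-- Since pushouts are determined only up to isomorphism, S_r(f) is
-- described relationally: any pushout (r₁ , g) with g total.

SpoFunctorial : Set₁
SpoFunctorial =
  (∀ {L R : Graph} (r : PHom L R) → IsPartialMono r →
     ConflictFree r (idₕ {L}) ×
     (∀ {R₁ : Graph} (r₁ : PHom L R₁) (g : Hom R R₁) →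
        IsPushout r idₕ r₁ (toP g) →
        EqUpToIso r₁ idₕ g r idₕ idₕ))
  ×
  (∀ {L R L₁ R₁ L₂ R₂ : Graph} (r : PHom L R) → IsPartialMono r →
     (f₁ : Hom L L₁) → ConflictFree r f₁ →
     (r₁ : PHom L₁ R₁) (g₁ : Hom R R₁) → IsPushout r f₁ r₁ (toP g₁) →
     (f₂ : Hom L₁ L₂) → ConflictFree r₁ f₂ →
     (r₂ : PHom L₂ R₂) (g₂ : Hom R₁ R₂) → IsPushout r₁ f₂ r₂ (toP g₂) →
     ConflictFree r (f₂ ∘ₕ f₁) ×
     (∀ {R' : Graph} (r' : PHom L₂ R') (g' : Hom R R') →
        IsPushout r (f₂ ∘ₕ f₁) r' (toP g') →
        EqUpToIso r₂ (f₂ ∘ₕ f₁) (g₂ ∘ₕ g₁) r' (f₂ ∘ₕ f₁) g'))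

-- Pushouts in Graphᵖ paste: if (r₁, g₁) is a pushout of (r, f₁) and (r₂, g₂) one of (r₁, f₂),
-- then (r₂, g₂ ∘ g₁) is a pushout of (r, f₂ ∘ f₁); along the identity, (r, id) is a pushout.
-- Any two pushouts of the same span are related by an isomorphism of Graphᵖ, and an
-- isomorphism of Graphᵖ is total, i.e. an isomorphism of Graph; this gives both functoriality
-- equations up to isomorphism.  Conflict-freeness of f₂ ∘ f₁ w.r.t. r follows from that of
-- f₂ w.r.t. r₁, since by the pushout square f₁ maps dom(r) into dom(r₁) and its complement
-- into the complement of dom(r₁).
module Submission where

open import Data.Maybe using (Maybe; just; nothing; _>>=_)
open import Data.Maybe.Properties using (just-injective)
open import Data.Product using (Σ; _×_; _,_; proj₁; proj₂)
open import Function.Base using (case_of_)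
open import Level using (0ℓ)
open import Relation.Binary.Bundles using (Setoid)
open import Relation.Binary.PropositionalEquality using (_≡_; refl; sym; trans; cong)
import Relation.Binary.Reasoning.Setoid as SetoidReasoning

open import Defs

>>=-identityʳ : ∀ {A : Set} (m : Maybe A) → (m >>= just) ≡ m
>>=-identityʳ (just x) = refl
>>=-identityʳ nothing  = refl

>>=-assoc : ∀ {A B C : Set} (m : Maybe A) (f : A → Maybe B) (g : B → Maybe C) →
            ((m >>= f) >>= g) ≡ (m >>= λ x → f x >>= g)
>>=-assoc (just x) f g = refl
>>=-assoc nothing  f g = refl

>>=-cong : ∀ {A B : Set} {m m' : Maybe A} {f g : A → Maybe B} →
           m ≡ m' → (∀ x → f x ≡ g x) → (m >>= f) ≡ (m' >>= g)
>>=-cong {m = just x}  refl f≗g = f≗g x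
>>=-cong {m = nothing} refl f≗g = refl

>>=≡just⇒defined : ∀ {A B : Set} (m : Maybe A) (f : A → Maybe B) {b : B} →
                   (m >>= f) ≡ just b → Σ A λ a → m ≡ just a
>>=≡just⇒defined (just a) f _ = a , refl

-- _≈ₚ_ is a product of Π-types, from which Agda cannot recover the two morphisms;
-- wrapped in a record they become inferable.
record _≋_ {G H : Graph} (p q : PHom G H) : Set where
  constructor ⟨_⟩
  field un : p ≈ₚ q
open _≋_

module _ {G H : Graph} where

  ≋-refl : {p : PHom G H} → p ≋ p
  ≋-refl = ⟨ (λ _ → refl) , (λ _ → refl) ⟩

  ≋-sym : {p q : PHom G H} → p ≋ q → q ≋ p
  ≋-sym ⟨ pN≗ , pE≗ ⟩ = ⟨ (λ x → sym (pN≗ x)) , (λ e → sym (pE≗ e)) ⟩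

  ≋-trans : {p q s : PHom G H} → p ≋ q → q ≋ s → p ≋ s
  ≋-trans ⟨ pN≗ , pE≗ ⟩ ⟨ qN≗ , qE≗ ⟩ =
    ⟨ (λ x → trans (pN≗ x) (qN≗ x)) , (λ e → trans (pE≗ e) (qE≗ e)) ⟩

≋-setoid : Graph → Graph → Setoid 0ℓ 0ℓ
≋-setoid G H = record
  { Carrier       = PHom G H
  ; _≈_           = _≋_
  ; isEquivalence = record { refl = ≋-refl ; sym = ≋-sym ; trans = ≋-trans }
  }

open module ≋-Reasoning {G H : Graph} = SetoidReasoning (≋-setoid G H)
  using (begin_; step-≈-⟩; step-≈-⟨; _∎)

∘ₚ-cong : ∀ {G H K} {p p' : PHom G H} {q q' : PHom H K} →
          p ≋ p' → q ≋ q' → (q ∘ₚ p) ≋ (q' ∘ₚ p')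
∘ₚ-cong ⟨ pN≗ , pE≗ ⟩ ⟨ qN≗ , qE≗ ⟩ =
  ⟨ (λ x → >>=-cong (pN≗ x) qN≗) , (λ e → >>=-cong (pE≗ e) qE≗) ⟩

∘ₚ-congˡ : ∀ {G H K} (q : PHom H K) {p p' : PHom G H} → p ≋ p' → (q ∘ₚ p) ≋ (q ∘ₚ p')
∘ₚ-congˡ q p≋p' = ∘ₚ-cong p≋p' (≋-refl {p = q})

∘ₚ-congʳ : ∀ {G H K} (p : PHom G H) {q q' : PHom H K} → q ≋ q' → (q ∘ₚ p) ≋ (q' ∘ₚ p)
∘ₚ-congʳ p q≋q' = ∘ₚ-cong (≋-refl {p = p}) q≋q'

∘ₚ-assoc : ∀ {G H K M} (p : PHom G H) (q : PHom H K) (s : PHom K M) →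
           ((s ∘ₚ q) ∘ₚ p) ≋ (s ∘ₚ (q ∘ₚ p))
∘ₚ-assoc p q s = ⟨ (λ x → sym (>>=-assoc (pN p x) (pN q) (pN s)))
                 , (λ e → sym (>>=-assoc (pE p e) (pE q) (pE s))) ⟩

∘ₚ-identityˡ : ∀ {G H} (p : PHom G H) → (toP idₕ ∘ₚ p) ≋ p
∘ₚ-identityˡ p = ⟨ (λ x → >>=-identityʳ (pN p x)) , (λ e → >>=-identityʳ (pE p e)) ⟩

toP-∘ₕ : ∀ {G H K} (g : Hom H K) (f : Hom G H) → toP (g ∘ₕ f) ≋ (toP g ∘ₚ toP f)
toP-∘ₕ g f = ⟨ (λ _ → refl) , (λ _ → refl) ⟩

∘ₚ-toP-∘ₕ : ∀ {G H K M} (p : PHom K M) (g : Hom H K) (f : Hom G H) →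
            (p ∘ₚ toP (g ∘ₕ f)) ≋ ((p ∘ₚ toP g) ∘ₚ toP f)
∘ₚ-toP-∘ₕ p g f = ⟨ (λ _ → refl) , (λ _ → refl) ⟩

toP-faithful : ∀ {G H} {f g : Hom G H} → toP f ≋ toP g → f ≈ₕ g
toP-faithful ⟨ fN≗ , fE≗ ⟩ = (λ x → just-injective (fN≗ x)) , (λ e → just-injective (fE≗ e))

∘ₚ-cancel : ∀ {G H K} {w : PHom H K} {u : PHom K H} {s : PHom G H} {t : PHom G K} →
            (w ∘ₚ s) ≋ t → (u ∘ₚ t) ≋ s → ((u ∘ₚ w) ∘ₚ s) ≋ (toP idₕ ∘ₚ s)
∘ₚ-cancel {w = w} {u} {s} {t} w∘s≋t u∘t≋s = begin
  (u ∘ₚ w) ∘ₚ s    ≈⟨ ∘ₚ-assoc s w u ⟩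
  u ∘ₚ (w ∘ₚ s)    ≈⟨ ∘ₚ-congˡ u w∘s≋t ⟩
  u ∘ₚ t           ≈⟨ u∘t≋s ⟩
  s                ≈⟨ ∘ₚ-identityˡ s ⟨
  toP idₕ ∘ₚ s     ∎

module _ {G H : Graph} {w : PHom G H} {u : PHom H G} (u∘w≋id : (u ∘ₚ w) ≋ toP idₕ) where

  private
    wN : ∀ x → Σ (Node H) λ y → pN w x ≡ just y
    wN x = >>=≡just⇒defined (pN w x) (pN u) (proj₁ (un u∘w≋id) x)

    wE : ∀ e → Σ (Edge H) λ y → pE w e ≡ just y
    wE e = >>=≡just⇒defined (pE w e) (pE u) (proj₂ (un u∘w≋id) e)

  totalise : Hom G H
  totalise = record
    { fN   = λ x → proj₁ (wN x)
    ; fE   = λ e → proj₁ (wE e)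
    ; fSrc = λ e → just-injective (trans (sym (pSrc w e _ (proj₂ (wE e)))) (proj₂ (wN (src G e))))
    ; fTgt = λ e → just-injective (trans (sym (pTgt w e _ (proj₂ (wE e)))) (proj₂ (wN (tgt G e))))
    }

  toP-totalise : toP totalise ≋ w
  toP-totalise = ⟨ (λ x → sym (proj₂ (wN x))) , (λ e → sym (proj₂ (wE e))) ⟩

Graphᵖ-iso⇒IsIso : ∀ {G H} {w : PHom G H} {u : PHom H G} →
                   (u ∘ₚ w) ≋ toP idₕ → (w ∘ₚ u) ≋ toP idₕ →
                   Σ (Hom G H) λ h → IsIso h × toP h ≋ w
Graphᵖ-iso⇒IsIso {w = w} {u} u∘w≋id w∘u≋id =
  h , (h⁻¹ , inverse h h⁻¹ toP-h toP-h⁻¹ u∘w≋id , inverse h⁻¹ h toP-h⁻¹ toP-h w∘u≋id) , toP-h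
  where
  h : Hom _ _
  h = totalise {w = w} {u} u∘w≋id
  h⁻¹ : Hom _ _
  h⁻¹ = totalise {w = u} {w} w∘u≋id
  toP-h : toP h ≋ w
  toP-h = toP-totalise {w = w} {u} u∘w≋id
  toP-h⁻¹ : toP h⁻¹ ≋ u
  toP-h⁻¹ = toP-totalise {w = u} {w} w∘u≋id

  inverse : ∀ {A B} (a : Hom A B) (b : Hom B A) {p : PHom A B} {q : PHom B A} →
            toP a ≋ p → toP b ≋ q → (q ∘ₚ p) ≋ toP idₕ → (b ∘ₕ a) ≈ₕ idₕ
  inverse a b a≋p b≋q q∘p≋id =
    toP-faithful (≋-trans (toP-∘ₕ b a) (≋-trans (∘ₚ-cong a≋p b≋q) q∘p≋id))

IsIso-idₕ : ∀ {G} → IsIso (idₕ {G})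
IsIso-idₕ = idₕ , ((λ _ → refl) , (λ _ → refl)) , ((λ _ → refl) , (λ _ → refl))

module Pushout {L R L₁ R₁ : Graph} {r : PHom L R} {f : Hom L L₁} {r₁ : PHom L₁ R₁} {g : PHom R R₁}
               (P : IsPushout r f r₁ g) where

  square : (g ∘ₚ r) ≋ (r₁ ∘ₚ toP f)
  square = ⟨ proj₁ P ⟩

  module _ {X : Graph} {a : PHom R X} {b : PHom L₁ X} (cocone : (a ∘ₚ r) ≋ (b ∘ₚ toP f)) where

    private
      universal = proj₂ P X a b (un cocone)

    mediator : PHom R₁ X
    mediator = proj₁ universal

    mediator-∘g : (mediator ∘ₚ g) ≋ a
    mediator-∘g = ⟨ proj₁ (proj₂ universal) ⟩

    mediator-∘r₁ : (mediator ∘ₚ r₁) ≋ b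
    mediator-∘r₁ = ⟨ proj₁ (proj₂ (proj₂ universal)) ⟩

    mediator-unique : (v : PHom R₁ X) → (v ∘ₚ g) ≋ a → (v ∘ₚ r₁) ≋ b → v ≋ mediator
    mediator-unique v v∘g≋a v∘r₁≋b = ⟨ proj₂ (proj₂ (proj₂ universal)) v (un v∘g≋a) (un v∘r₁≋b) ⟩

  ∘-cocone : ∀ {X} (v : PHom R₁ X) → ((v ∘ₚ g) ∘ₚ r) ≋ ((v ∘ₚ r₁) ∘ₚ toP f)
  ∘-cocone v = begin
    (v ∘ₚ g) ∘ₚ r          ≈⟨ ∘ₚ-assoc r g v ⟩
    v ∘ₚ (g ∘ₚ r)          ≈⟨ ∘ₚ-congˡ v square ⟩
    v ∘ₚ (r₁ ∘ₚ toP f)     ≈⟨ ∘ₚ-assoc (toP f) r₁ v ⟨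
    (v ∘ₚ r₁) ∘ₚ toP f     ∎

  jointly-epic : ∀ {X} (v w : PHom R₁ X) →
                 (v ∘ₚ g) ≋ (w ∘ₚ g) → (v ∘ₚ r₁) ≋ (w ∘ₚ r₁) → v ≋ w
  jointly-epic v w v∘g≋w∘g v∘r₁≋w∘r₁ =
    ≋-trans (mediator-unique (∘-cocone w) v v∘g≋w∘g v∘r₁≋w∘r₁)
            (≋-sym (mediator-unique (∘-cocone w) w ≋-refl ≋-refl))

pushout-unique : ∀ {L R L₁ Ra Rb} {r : PHom L R} {f : Hom L L₁}
                   {ra : PHom L₁ Ra} {ga : PHom R Ra} {rb : PHom L₁ Rb} {gb : PHom R Rb} →
                 IsPushout r f ra ga → IsPushout r f rb gb →
                 Σ (Hom Ra Rb) λ h → IsIso h × (toP h ∘ₚ ra) ≋ rb × (toP h ∘ₚ ga) ≋ gb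
pushout-unique {r = r} {f} {ra} {ga} {rb} {gb} Pa Pb =
  let h , h-iso , toP-h≋w = Graphᵖ-iso⇒IsIso u∘w≋id w∘u≋id in
  h , h-iso , ≋-trans (∘ₚ-congʳ ra toP-h≋w) (A.mediator-∘r₁ B.square)
            , ≋-trans (∘ₚ-congʳ ga toP-h≋w) (A.mediator-∘g B.square)
  where
  module A = Pushout {r = r} {f} {ra} {ga} Pa
  module B = Pushout {r = r} {f} {rb} {gb} Pb

  w : PHom _ _
  w = A.mediator B.square
  u : PHom _ _
  u = B.mediator A.square

  u∘w≋id : (u ∘ₚ w) ≋ toP idₕ
  u∘w≋id = A.jointly-epic (u ∘ₚ w) (toP idₕ)
    (∘ₚ-cancel (A.mediator-∘g B.square) (B.mediator-∘g A.square))
    (∘ₚ-cancel (A.mediator-∘r₁ B.square) (B.mediator-∘r₁ A.square))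

  w∘u≋id : (w ∘ₚ u) ≋ toP idₕ
  w∘u≋id = B.jointly-epic (w ∘ₚ u) (toP idₕ)
    (∘ₚ-cancel (B.mediator-∘g A.square) (A.mediator-∘g B.square))
    (∘ₚ-cancel (B.mediator-∘r₁ A.square) (A.mediator-∘r₁ B.square))

pushout-EqUpToIso : ∀ {L R L₁ Ra Rb} {r : PHom L R} {f : Hom L L₁}
                      {ra : PHom L₁ Ra} {ga : Hom R Ra} {rb : PHom L₁ Rb} {gb : Hom R Rb} →
                    IsPushout r f ra (toP ga) → IsPushout r f rb (toP gb) →
                    EqUpToIso ra f ga rb f gb
pushout-EqUpToIso {r = r} {f} {ra} {ga} {rb} {gb} Pa Pb
  with pushout-unique {r = r} {f} {ra} {toP ga} {rb} {toP gb} Pa Pb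
... | h , h-iso , h∘ra≋rb , h∘ga≋gb =
  idₕ , h , IsIso-idₕ , h-iso , un h∘ra≋rb , ((λ _ → refl) , (λ _ → refl))
      , toP-faithful {f = h ∘ₕ ga} {g = gb} (≋-trans (toP-∘ₕ h ga) h∘ga≋gb)

pushout-idₕ : ∀ {L R} (r : PHom L R) → IsPushout r idₕ r (toP idₕ)
pushout-idₕ r = un (∘ₚ-identityˡ r) , λ X a b a∘r≈b → a , un (≋-refl {p = a}) , a∘r≈b , λ v v≈a _ → v≈a

pushout-paste : ∀ {L R L₁ R₁ L₂ R₂} {r : PHom L R} {f₁ : Hom L L₁} {r₁ : PHom L₁ R₁} {g₁ : Hom R R₁}
                  {f₂ : Hom L₁ L₂} {r₂ : PHom L₂ R₂} {g₂ : Hom R₁ R₂} →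
                IsPushout r f₁ r₁ (toP g₁) → IsPushout r₁ f₂ r₂ (toP g₂) →
                IsPushout r (f₂ ∘ₕ f₁) r₂ (toP (g₂ ∘ₕ g₁))
pushout-paste {r = r} {f₁} {r₁} {g₁} {f₂} {r₂} {g₂} P₁ P₂ = un outer-square , universal
  where
  module P₁ = Pushout {r = r} {f₁} {r₁} {toP g₁} P₁
  module P₂ = Pushout {r = r₁} {f₂} {r₂} {toP g₂} P₂

  outer-square : (toP (g₂ ∘ₕ g₁) ∘ₚ r) ≋ (r₂ ∘ₚ toP (f₂ ∘ₕ f₁))
  outer-square = begin
    toP (g₂ ∘ₕ g₁) ∘ₚ r           ≈⟨ ∘ₚ-congʳ r (toP-∘ₕ g₂ g₁) ⟩
    (toP g₂ ∘ₚ toP g₁) ∘ₚ r       ≈⟨ ∘ₚ-assoc r (toP g₁) (toP g₂) ⟩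
    toP g₂ ∘ₚ (toP g₁ ∘ₚ r)       ≈⟨ ∘ₚ-congˡ (toP g₂) P₁.square ⟩
    toP g₂ ∘ₚ (r₁ ∘ₚ toP f₁)      ≈⟨ ∘ₚ-assoc (toP f₁) r₁ (toP g₂) ⟨
    (toP g₂ ∘ₚ r₁) ∘ₚ toP f₁      ≈⟨ ∘ₚ-congʳ (toP f₁) P₂.square ⟩
    (r₂ ∘ₚ toP f₂) ∘ₚ toP f₁      ≈⟨ ∘ₚ-toP-∘ₕ r₂ f₂ f₁ ⟨
    r₂ ∘ₚ toP (f₂ ∘ₕ f₁)          ∎

  universal : ∀ X (a : PHom _ X) (b : PHom _ X) → (a ∘ₚ r) ≈ₚ (b ∘ₚ toP (f₂ ∘ₕ f₁)) →
              Σ (PHom _ X) λ u → ((u ∘ₚ toP (g₂ ∘ₕ g₁)) ≈ₚ a) × ((u ∘ₚ r₂) ≈ₚ b) ×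
                (∀ v → (v ∘ₚ toP (g₂ ∘ₕ g₁)) ≈ₚ a → (v ∘ₚ r₂) ≈ₚ b → v ≈ₚ u)
  universal X a b cocone = u₂ , un u₂∘g≋a , un (P₂.mediator-∘r₁ cocone₂) , λ v v∘g≈a v∘r₂≈b →
    un (P₂.mediator-unique cocone₂ v (v∘g₂≋u₁ v ⟨ v∘g≈a ⟩ ⟨ v∘r₂≈b ⟩) ⟨ v∘r₂≈b ⟩)
    where
    cocone₁ : (a ∘ₚ r) ≋ ((b ∘ₚ toP f₂) ∘ₚ toP f₁)
    cocone₁ = ≋-trans ⟨ cocone ⟩ (∘ₚ-toP-∘ₕ b f₂ f₁)

    u₁ : PHom _ X
    u₁ = P₁.mediator cocone₁

    cocone₂ : (u₁ ∘ₚ r₁) ≋ (b ∘ₚ toP f₂)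
    cocone₂ = P₁.mediator-∘r₁ cocone₁

    u₂ : PHom _ X
    u₂ = P₂.mediator cocone₂

    u₂∘g≋a : (u₂ ∘ₚ toP (g₂ ∘ₕ g₁)) ≋ a
    u₂∘g≋a = begin
      u₂ ∘ₚ toP (g₂ ∘ₕ g₁)        ≈⟨ ∘ₚ-toP-∘ₕ u₂ g₂ g₁ ⟩
      (u₂ ∘ₚ toP g₂) ∘ₚ toP g₁    ≈⟨ ∘ₚ-congʳ (toP g₁) (P₂.mediator-∘g cocone₂) ⟩
      u₁ ∘ₚ toP g₁                ≈⟨ P₁.mediator-∘g cocone₁ ⟩
      a                           ∎

    v∘g₂≋u₁ : (v : PHom _ X) → (v ∘ₚ toP (g₂ ∘ₕ g₁)) ≋ a → (v ∘ₚ r₂) ≋ b → (v ∘ₚ toP g₂) ≋ u₁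
    v∘g₂≋u₁ v v∘g≋a v∘r₂≋b = P₁.mediator-unique cocone₁ (v ∘ₚ toP g₂)
      (≋-trans (≋-sym (∘ₚ-toP-∘ₕ v g₂ g₁)) v∘g≋a)
      (begin
        (v ∘ₚ toP g₂) ∘ₚ r₁       ≈⟨ ∘ₚ-assoc r₁ (toP g₂) v ⟩
        v ∘ₚ (toP g₂ ∘ₚ r₁)       ≈⟨ ∘ₚ-congˡ v P₂.square ⟩
        v ∘ₚ (r₂ ∘ₚ toP f₂)       ≈⟨ ∘ₚ-assoc (toP f₂) r₂ v ⟨
        (v ∘ₚ r₂) ∘ₚ toP f₂       ≈⟨ ∘ₚ-congʳ (toP f₂) v∘r₂≋b ⟩
        b ∘ₚ toP f₂               ∎)

ConflictFree-idₕ : ∀ {L R} (r : PHom L R) → ConflictFree r idₕ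
ConflictFree-idₕ r =
    (λ { x .x _ rx≡just rx≡nothing refl → case trans (sym rx≡just) rx≡nothing of λ () })
  , (λ { e .e _ re≡just re≡nothing refl → case trans (sym re≡just) re≡nothing of λ () })

ConflictFree-∘ₕ : ∀ {L R L₁ R₁ L₂} {r : PHom L R} {f₁ : Hom L L₁} {r₁ : PHom L₁ R₁} {g₁ : Hom R R₁}
                    {f₂ : Hom L₁ L₂} →
                  (toP g₁ ∘ₚ r) ≈ₚ (r₁ ∘ₚ toP f₁) → ConflictFree r₁ f₂ → ConflictFree r (f₂ ∘ₕ f₁)
ConflictFree-∘ₕ {r = r} {f₁} {r₁} {g₁} (squareN , squareE) (conflict-freeN , conflict-freeE) =
    (λ x y z rx ry → conflict-freeN (fN f₁ x) (fN f₁ y) (fN g₁ z) (r₁N x rx) (r₁N y ry))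
  , (λ e d c re rd → conflict-freeE (fE f₁ e) (fE f₁ d) (fE g₁ c) (r₁E e re) (r₁E d rd))
  where
  r₁N : ∀ x {m} → pN r x ≡ m → pN r₁ (fN f₁ x) ≡ (m >>= λ y → just (fN g₁ y))
  r₁N x rx≡m = trans (sym (squareN x)) (cong (_>>= λ y → just (fN g₁ y)) rx≡m)

  r₁E : ∀ e {m} → pE r e ≡ m → pE r₁ (fE f₁ e) ≡ (m >>= λ c → just (fE g₁ c))
  r₁E e re≡m = trans (sym (squareE e)) (cong (_>>= λ c → just (fE g₁ c)) re≡m)

proposition3p3 : SpoFunctorial
proposition3p3 =
    (λ r _ → ConflictFree-idₕ r
           , λ r₁ g P → pushout-EqUpToIso {r = r} {idₕ} {r₁} {g} {r} {idₕ} P (pushout-idₕ r))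
  , (λ r _ f₁ _ r₁ g₁ P₁ f₂ conflict-free₂ r₂ g₂ P₂ →
       ConflictFree-∘ₕ {r = r} {f₁} {r₁} {g₁} {f₂} (proj₁ P₁) conflict-free₂
     , λ r' g' P → pushout-EqUpToIso {r = r} {f₂ ∘ₕ f₁} {r₂} {g₂ ∘ₕ g₁} {r'} {g'}
                     (pushout-paste {r = r} {f₁} {r₁} {g₁} {f₂} {r₂} {g₂} P₁ P₂) P)
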